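{- Let $(T,\lambda)$ be an edge-labeled phylogenetic tree explaining $\mathcal{X}$, let $e$ be an inner 0-edge or an irrelevant 1-edge of $(T,\lambda)$, and let $(T_e,\lambda_e)$ be the tree obtained from $(T,\lambda)$ by contracting $e$. Then an edge $f\neq e$ is relevant in $(T_e,\lambda_e)$ if and only if $f$ is relevant in $(T,\lambda)$.
   Context: Phylogenetic tree: rooted, root degree $\ge2$, other inner vertices degree $\ge3$; inner edges join two inner vertices. $\lambda:E\to\{0,1\}$. $\mathcal{X}_{(T,\lambda)}$: $(x,y)$ for distinct leaves with an edge labeled $1$ on the path from $\operatorname{lca}(x,y)$ to $y$; explains means equality of relations. An edge $e$ is irrelevant if changing only its label does not change $\mathcal{X}_{(T,\lambda)}$, relevant otherwise. (Irrelevant edges are always inner edges.) Contraction of an inner edge: remove it and identify its endpoints, keeping all other labels. -}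

module Defs where

open import Data.Bool using (Bool; true; false; not)
open import Data.Maybe using (Maybe; just; nothing; _>>=_)
open import Data.Nat using (ℕ; zero; suc)
open import Data.List using (List)
open import Data.List.Membership.Propositional using (_∈_)
open import Data.Product using (Σ; ∃; ∃-syntax; _×_; _,_; proj₁)
open import Relation.Nullary using (¬_; Dec; yes; no)
open import Relation.Nullary.Decidable using (False; fromWitnessFalse)
open import Relation.Binary.PropositionalEquality using (_≡_; _≢_)
open import Relation.Binary.Definitions using (DecidableEquality)
open import Function.Bundles using (_⇔_)

-- Every edge is the pair (p , v) with  parent v ≡ just p ; we identify the edge
-- with its lower endpoint (child) v.
record RTree : Set₁ where
  field
    V      : Set
    parent : V → Maybe V

module _ (T : RTree) where
  open RTree T

  up : ℕ → V → Maybe V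
  up zero    v = just v
  up (suc k) v = parent v >>= up k

  -- w ≼ y : w is an ancestor of y or w = y
  _≼_ : V → V → Set
  w ≼ y = ∃[ k ] (up k y ≡ just w)

  IsRoot : V → Set
  IsRoot v = parent v ≡ nothing

  IsEdge : V → Set
  IsEdge v = ∃[ p ] (parent v ≡ just p)

  IsLeaf : V → Set
  IsLeaf v = ∀ u → parent u ≢ just v

  IsInner : V → Set
  IsInner v = ¬ IsLeaf v

  -- the edge (parent v , v) is an inner edge: both endpoints inner
  -- (the upper endpoint has the child v, hence is automatically inner)
  IsInnerEdge : V → Set
  IsInnerEdge v = IsEdge v × IsInner v

  -- Phylogenetic tree: finite, unique root, every vertex reaches the root
  -- (acyclic), and every inner vertex has at least two children
  -- (= root degree ≥ 2, non-root inner vertices degree ≥ 3).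
  record Phylogenetic : Set where
    field
      finite     : ∃[ xs ] (∀ (v : V) → v ∈ xs)
      root       : V
      root-root  : IsRoot root
      root-uniq  : ∀ v → IsRoot v → v ≡ root
      reach-root : ∀ v → ∃[ k ] (up k v ≡ nothing)
      branching  : ∀ v → IsInner v →
                   ∃[ a ] ∃[ b ] (a ≢ b × parent a ≡ just v × parent b ≡ just v)

  -- Edge labelings: the label of the edge (parent v , v) is lab v
  -- (the value at the root is never used).
  Labeling : Set
  Labeling = V → Bool

  -- (x , y) ∈ X_(T,lab): x, y distinct leaves and some 1-edge lies on the path
  -- from lca(x,y) to y, i.e. an edge (parent w , w) with w ≼ y and not w ≼ x.
  𝒳 : Labeling → V → V → Set
  𝒳 lab x y = IsLeaf x × IsLeaf y × x ≢ y ×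
              ∃[ w ] (IsEdge w × lab w ≡ true × w ≼ y × ¬ (w ≼ x))

  SameRel : Labeling → Labeling → Set
  SameRel l₁ l₂ = ∀ x y → (𝒳 l₁ x y ⇔ 𝒳 l₂ x y)

  Irrelevant : Labeling → V → Set
  Irrelevant lab f = ∀ (lab' : Labeling) → lab' f ≡ not (lab f) →
                     (∀ w → w ≢ f → lab' w ≡ lab w) → SameRel lab lab'

  Relevant : Labeling → V → Set
  Relevant lab f = ¬ Irrelevant lab f

-- Contraction of the edge (parent v , v): remove v, children of v become
-- children of parent v.  Vertex set is  V ∖ {v}.
module _ (T : RTree) (_≟_ : DecidableEquality (RTree.V T)) (v : RTree.V T) where
  open RTree T

  CV : Set
  CV = Σ V (λ u → False (u ≟ v))

  private
    embed : Maybe V → Maybe CV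
    embed nothing  = nothing
    embed (just p) with p ≟ v
    ... | yes _ = nothing   -- impossible for v ≠ root in a tree
    ... | no np = just (p , fromWitnessFalse np)

    redirect : V → Maybe V
    redirect p with p ≟ v
    ... | yes _ = parent v
    ... | no _  = just p

  contract : RTree
  contract = record { V = CV ; parent = λ u → embed (parent (proj₁ u) >>= redirect) }

  contractLab : Labeling T → Labeling contract
  contractLab lab u = lab (proj₁ u)

-- Irrelevance of f is rephrased as "toggling the label of f does not change
-- 𝒳"; for a 1-edge this means that no pair is lost, for a 0-edge that no pair
-- is gained.  If e is inner and labeled 0, contracting e is a bijection
--     between the leaves of T and of Tₑ preserving ancestry among the
--     remaining vertices, so 𝒳 is unchanged; toggling f commutes with
--     contraction, hence f is irrelevant in Tₑ iff it is irrelevant in T.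
--   * Switching off an irrelevant 1-edge e.  Then e is inner, and for f ≠ e
--     irrelevance is the same before and after switching e off.  The only
--     nontrivial case is a pair explained only through e and f, both on its
--     path; it is rerouted through a leaf beside the lower of the two edges.
-- The theorem combines them: in the second case the contracted labelings
-- before and after switching e off coincide.
module Submission where

open import Defs
open import Data.Bool using (true; false; not; if_then_else_)
open import Data.Bool.Properties using (T-irrelevant)
open import Data.Maybe using (Maybe; just; nothing; _>>=_)
import Data.Maybe
open import Data.Maybe.Properties using (just-injective)
import Data.Maybe.Properties as MaybeP
open import Data.Nat using (zero; suc; _<_)
open import Data.Nat.Properties using (≤-refl; ≤-trans; ≤-pred)
open import Data.List using (List; length; filter)
open import Data.List.Properties using (filter-notAll)
open import Data.List.Membership.Propositional using (_∈_; lose)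
open import Data.List.Membership.Propositional.Properties using (∈-filter⁺)
open import Data.List.Relation.Unary.Any using (any?; satisfied)
open import Data.Product using (∃-syntax; _×_; _,_; proj₁; proj₂)
open import Data.Sum using (_⊎_; inj₁; inj₂; [_,_]) renaming (map to map-⊎)
open import Data.Empty using (⊥-elim)
open import Relation.Nullary using (¬_; yes; no; ¬?; does)
open import Relation.Nullary.Decidable using (False; fromWitnessFalse; toWitnessFalse; map′; dec-true; dec-false)
open import Relation.Binary.PropositionalEquality using (_≡_; _≢_; _≗_; refl; sym; trans; cong; subst)
open import Relation.Binary.Definitions using (DecidableEquality)
open import Function using (_∘_)
open import Function.Bundles using (_⇔_; mk⇔; Equivalence)
import Function.Properties.Equivalence as ⇔
open import Function.Related.TypeIsomorphisms using (¬-cong-⇔)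

module Ancestry (R : RTree) where
  open RTree R

  data Anc : V → V → Set where
    here  : ∀ {w} → Anc w w
    there : ∀ {w y p} → parent y ≡ just p → Anc w p → Anc w y

  Anc⇒≼ : ∀ {w y} → Anc w y → _≼_ R w y
  Anc⇒≼ here = 0 , refl
  Anc⇒≼ (there {y = y} py a) =
    let (k , upk) = Anc⇒≼ a in suc k , trans (cong (_>>= up R k) py) upk

  ≼⇒Anc : ∀ {w y} → _≼_ R w y → Anc w y
  ≼⇒Anc (k , upk) = climb k upk
    where
    climb : ∀ k {w y} → up R k y ≡ just w → Anc w y
    climb zero refl = here
    climb (suc k) {y = y} upk with parent y in py
    climb (suc k) () | nothing
    climb (suc k) upk | just p = there py (climb k upk)

  Anc-trans : ∀ {a b c} → Anc a b → Anc b c → Anc a c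
  Anc-trans ab here = ab
  Anc-trans ab (there pc bp) = there pc (Anc-trans ab bp)

  Anc-linear : ∀ {a b y} → Anc a y → Anc b y → Anc a b ⊎ Anc b a
  Anc-linear here by = inj₂ by
  Anc-linear (there py ap) here = inj₁ (there py ap)
  Anc-linear (there py ap) (there py′ bp) with trans (sym py) py′
  ... | refl = Anc-linear ap bp

  Anc-proper : ∀ {a b p} → Anc a b → a ≢ b → parent b ≡ just p → Anc a p
  Anc-proper here a≢b pb = ⊥-elim (a≢b refl)
  Anc-proper (there pb′ ap) a≢b pb with trans (sym pb) pb′
  ... | refl = ap

  ≼-refl : ∀ {w} → _≼_ R w w
  ≼-refl = Anc⇒≼ here

  ≼-trans : ∀ {a b c} → _≼_ R a b → _≼_ R b c → _≼_ R a c
  ≼-trans ab bc = Anc⇒≼ (Anc-trans (≼⇒Anc ab) (≼⇒Anc bc))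

  ≼-linear : ∀ {a b y} → _≼_ R a y → _≼_ R b y → _≼_ R a b ⊎ _≼_ R b a
  ≼-linear ay by = map-⊎ Anc⇒≼ Anc⇒≼ (Anc-linear (≼⇒Anc ay) (≼⇒Anc by))

  ≼-proper : ∀ {a b p} → _≼_ R a b → a ≢ b → parent b ≡ just p → _≼_ R a p
  ≼-proper ab a≢b pb = Anc⇒≼ (Anc-proper (≼⇒Anc ab) a≢b pb)

module PhylogeneticTree (R : RTree) (_≟_ : DecidableEquality (RTree.V R))
                        (ph : Phylogenetic R) where
  open RTree R
  open Phylogenetic ph
  open Ancestry R

  -- a vertex that is an ancestor of its own parent lies on a cycle, and the
  -- iterated parents along a cycle never reach the root
  acyclic : ∀ {b p} → parent b ≡ just p → ¬ Anc b p
  acyclic {b} pb bp = let (K , upK) = reach-root b in never-root K here upK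
    where
    never-root : ∀ n {u} → Anc b u → up R n u ≢ nothing
    never-root zero _ ()
    never-root (suc n) here upn rewrite pb = never-root n bp upn
    never-root (suc n) (there pu r) upn rewrite pu = never-root n r upn

  Anc-antisym : ∀ {a b} → Anc a b → Anc b a → a ≡ b
  Anc-antisym ab here = refl
  Anc-antisym ab (there pa bq) = ⊥-elim (acyclic pa (Anc-trans ab bq))

  ≼-antisym : ∀ {a b} → _≼_ R a b → _≼_ R b a → a ≡ b
  ≼-antisym ab ba = Anc-antisym (≼⇒Anc ab) (≼⇒Anc ba)

  below-not-above : ∀ {a b u} → _≼_ R a b → _≼_ R b u → a ≢ b → u ≢ a
  below-not-above ab bu a≢b refl = a≢b (≼-antisym ab bu)

  -- Every vertex has a leaf among its descendants: descend to children while
  -- possible; the descendants of a child exclude the vertex itself, so the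
  -- list of candidates shrinks at every step.
  leaf-below : ∀ c → ∃[ ℓ ] (IsLeaf R ℓ × Anc c ℓ)
  leaf-below c = descend (suc (length vertices)) c vertices ≤-refl (λ v _ → all∈ v)
    where
    vertices : List V
    vertices = proj₁ finite
    all∈ : ∀ v → v ∈ vertices
    all∈ = proj₂ finite
    _≟ₘ_ : DecidableEquality (Maybe V)
    _≟ₘ_ = MaybeP.≡-dec _≟_

    descend : ∀ n c (L : List V) → length L < n → (∀ v → Anc c v → v ∈ L) →
              ∃[ ℓ ] (IsLeaf R ℓ × Anc c ℓ)
    descend zero c L () covers
    descend (suc n) c L len covers
      with any? (λ u → parent u ≟ₘ just c) vertices
    ... | no noChild = c , (λ u pu → noChild (lose (all∈ u) pu)) , here
    ... | yes hasChild =
      let (c′ , pc′) = satisfied hasChild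
          c-c′ = there pc′ here
          (ℓ , leaf , c′-ℓ) =
            descend n c′ (filter (λ v → ¬? (v ≟ c)) L)
              (≤-trans (filter-notAll _ L (lose (covers c here) (λ c≢c → c≢c refl))) (≤-pred len))
              (λ v c′-v → ∈-filter⁺ _ (covers v (Anc-trans c-c′ c′-v))
                                      (λ { refl → acyclic pc′ c′-v }))
      in ℓ , leaf , Anc-trans c-c′ c′-ℓ

  siblings-disjoint : ∀ {a b p ℓ} → a ≢ b → parent a ≡ just p → parent b ≡ just p →
                      Anc a ℓ → ¬ Anc b ℓ
  siblings-disjoint a≢b pa pb aℓ bℓ with Anc-linear aℓ bℓ
  ... | inj₁ ab = acyclic pa (Anc-proper ab a≢b pb)
  ... | inj₂ ba = acyclic pb (Anc-proper ba (λ b≡a → a≢b (sym b≡a)) pa)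

  -- Below the upper end of every edge hangs a leaf outside the subtree of
  -- that edge (the inner vertex p has a second child).
  sibling-leaf : ∀ {b p} → parent b ≡ just p →
                 ∃[ x ] (IsLeaf R x × _≼_ R p x × ¬ _≼_ R b x)
  sibling-leaf {b} {p} pb =
    let (s , s≢b , ps) = other-child
        (x , leaf , sx) = leaf-below s
    in x , leaf , Anc⇒≼ (Anc-trans (there ps here) sx) ,
       (λ bx → siblings-disjoint s≢b ps pb sx (≼⇒Anc bx))
    where
    other-child : ∃[ s ] (s ≢ b × parent s ≡ just p)
    other-child with branching p (λ leaf → leaf b pb)
    ... | a , a′ , a≢a′ , pa , pa′ with a ≟ b
    ...   | yes refl = a′ , (λ a′≡a → a≢a′ (sym a′≡a)) , pa′
    ...   | no a≢b = a , a≢b , pa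

module Labelings (R : RTree) (_≟_ : DecidableEquality (RTree.V R)) where
  open RTree R

  Witness : Labeling R → V → V → V → Set
  Witness l x y w = IsEdge R w × l w ≡ true × _≼_ R w y × ¬ _≼_ R w x

  relabel : ∀ {l l′ : Labeling R} {x y w} → l′ w ≡ l w → Witness l x y w → Witness l′ x y w
  relabel eq (ew , lw , wy , ¬wx) = ew , trans eq lw , wy , ¬wx

  labels-differ : ∀ {l : Labeling R} {w b} → l w ≡ true → l b ≡ false → w ≢ b
  labels-differ lw lb refl with () ← trans (sym lw) lb

  _⊆𝒳_ : Labeling R → Labeling R → Set
  l ⊆𝒳 l′ = ∀ {x y} → 𝒳 R l x y → 𝒳 R l′ x y

  𝒳-mono : ∀ {l l′ : Labeling R} → (∀ w → l w ≡ true → l′ w ≡ true) → l ⊆𝒳 l′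
  𝒳-mono on (lx , ly , x≢y , w , ew , lw , wy , ¬wx) =
    lx , ly , x≢y , w , ew , on w lw , wy , ¬wx

  ⊆-except-1-edge : ∀ {l l′ : Labeling R} {e} → l′ e ≡ true →
                    (∀ w → w ≢ e → l w ≡ l′ w) → l ⊆𝒳 l′
  ⊆-except-1-edge {l} {l′} {e} l′e agree = 𝒳-mono on
    where
    on : ∀ w → l w ≡ true → l′ w ≡ true
    on w lw with w ≟ e
    ... | yes refl = l′e
    ... | no w≢e = trans (sym (agree w w≢e)) lw

  ⊆⇒SameRel : ∀ {l l′ : Labeling R} → l ⊆𝒳 l′ → l′ ⊆𝒳 l → SameRel R l l′
  ⊆⇒SameRel sub sup x y = mk⇔ (sub {x} {y}) (sup {x} {y})

  SameRel⇒⊆ : ∀ {l l′ : Labeling R} → SameRel R l l′ → l ⊆𝒳 l′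
  SameRel⇒⊆ same = Equivalence.to (same _ _)

  SameRel⇒⊇ : ∀ {l l′ : Labeling R} → SameRel R l l′ → l′ ⊆𝒳 l
  SameRel⇒⊇ same = Equivalence.from (same _ _)

  SameRel-trans : ∀ {l₁ l₂ l₃ : Labeling R} → SameRel R l₁ l₂ → SameRel R l₂ l₃ → SameRel R l₁ l₃
  SameRel-trans s t x y = ⇔.trans (s x y) (t x y)

  SameRel-ext : ∀ {l l′ : Labeling R} → l ≗ l′ → SameRel R l l′
  SameRel-ext l≗l′ = ⊆⇒SameRel (𝒳-mono (λ w lw → trans (sym (l≗l′ w)) lw))
                               (𝒳-mono (λ w l′w → trans (l≗l′ w) l′w))

  SameRel-respʳ : ∀ {l l₁ l₂ : Labeling R} → l₁ ≗ l₂ → SameRel R l l₁ ⇔ SameRel R l l₂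
  SameRel-respʳ l₁≗l₂ = mk⇔ (λ same → SameRel-trans same (SameRel-ext l₁≗l₂))
                            (λ same → SameRel-trans same (SameRel-ext (λ w → sym (l₁≗l₂ w))))

  Irrelevant-cong : ∀ {l l′ : Labeling R} {f} → l ≗ l′ → Irrelevant R l f ⇔ Irrelevant R l′ f
  Irrelevant-cong l≗l′ = mk⇔ (transport l≗l′) (transport (λ w → sym (l≗l′ w)))
    where
    transport : ∀ {l l′ : Labeling R} {f} → l ≗ l′ → Irrelevant R l f → Irrelevant R l′ f
    transport {f = f} l≗l′ irr lab′ lab′f agree =
      SameRel-trans (SameRel-ext (λ w → sym (l≗l′ w)))
        (irr lab′ (trans lab′f (cong not (sym (l≗l′ f))))
                  (λ w w≢f → trans (agree w w≢f) (sym (l≗l′ w))))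

  toggle : Labeling R → V → Labeling R
  toggle l f u = if does (u ≟ f) then not (l f) else l u

  toggle-same : ∀ {l f} → toggle l f f ≡ not (l f)
  toggle-same {f = f} rewrite dec-true (f ≟ f) refl = refl

  toggle-other : ∀ {l f u} → u ≢ f → toggle l f u ≡ l u
  toggle-other {f = f} {u} u≢f rewrite dec-false (u ≟ f) u≢f = refl

  Irrelevant⇔toggle : ∀ {l f} → Irrelevant R l f ⇔ SameRel R l (toggle l f)
  Irrelevant⇔toggle {l} {f} = mk⇔
    (λ irr → irr (toggle l f) (toggle-same {l}) (λ w → toggle-other))
    (λ same lab′ lab′f agree → SameRel-trans same (SameRel-ext (toggle≗ lab′f agree)))
    where
    toggle≗ : ∀ {lab′} → lab′ f ≡ not (l f) → (∀ w → w ≢ f → lab′ w ≡ l w) → toggle l f ≗ lab′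
    toggle≗ lab′f agree w with w ≟ f
    ... | yes refl = sym lab′f
    ... | no w≢f = sym (agree w w≢f)

  -- toggling a 1-edge can only lose pairs: it is irrelevant iff none is lost
  irrelevant-1-edge : ∀ {l f} → l f ≡ true → Irrelevant R l f ⇔ (l ⊆𝒳 toggle l f)
  irrelevant-1-edge {l} {f} lf = mk⇔ to from
    where
    to : Irrelevant R l f → l ⊆𝒳 toggle l f
    to irr = SameRel⇒⊆ (Equivalence.to Irrelevant⇔toggle irr)
    from : l ⊆𝒳 toggle l f → Irrelevant R l f
    from kept = Equivalence.from Irrelevant⇔toggle
                  (⊆⇒SameRel kept (⊆-except-1-edge lf (λ w → toggle-other)))

  -- toggling a 0-edge can only gain pairs: it is irrelevant iff none is gained
  irrelevant-0-edge : ∀ {l f} → l f ≡ false → Irrelevant R l f ⇔ (toggle l f ⊆𝒳 l)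
  irrelevant-0-edge {l} {f} lf = mk⇔ to from
    where
    to : Irrelevant R l f → toggle l f ⊆𝒳 l
    to irr = SameRel⇒⊇ (Equivalence.to Irrelevant⇔toggle irr)
    from : toggle l f ⊆𝒳 l → Irrelevant R l f
    from none-gained = Equivalence.from Irrelevant⇔toggle
                         (⊆⇒SameRel (⊆-except-1-edge (trans (toggle-same {l}) (cong not lf))
                                                       (λ w w≢f → sym (toggle-other w≢f)))
                                     none-gained)

module IrrelevantOneEdges (R : RTree) (_≟_ : DecidableEquality (RTree.V R))
                          (ph : Phylogenetic R) where
  open RTree R
  open Ancestry R
  open PhylogeneticTree R _≟_ ph
  open Labelings R _≟_

  -- For a leaf x′ beside b, m
  -- explains (x′,y) through b; the m′-witness of (x′,y) avoids x′, hence lies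
  -- strictly below b, and therefore also witnesses (x,y) in m′.
  reroute : ∀ {m m′ : Labeling R} {x y b} → IsLeaf R x → IsLeaf R y → IsEdge R b →
            _≼_ R b y → ¬ _≼_ R b x → m b ≡ true → m′ b ≡ false → m ⊆𝒳 m′ →
            ∃[ w ] (Witness m′ x y w × _≼_ R b w)
  reroute {m} {m′} {x} {y} {b} lx ly (p , pb) by ¬bx mb m′b m⊆m′
    with sibling-leaf pb
  ... | x′ , lx′ , px′ , ¬bx′
    with m⊆m′ (lx′ , ly , (λ { refl → ¬bx′ by }) , b , (p , pb) , mb , by , ¬bx′)
  ... | _ , _ , _ , w , ew , m′w , wy , ¬wx′ =
    w , (ew , m′w , wy , λ wx → ¬bx (≼-trans below-b wx)) , below-b
    where
    below-b : _≼_ R b w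
    below-b with ≼-linear wy by
    ... | inj₁ wb = ⊥-elim (¬wx′ (≼-trans (≼-proper wb (labels-differ m′w m′b) pb) px′))
    ... | inj₂ bw = bw

  -- an irrelevant 1-edge is an inner edge: were e a leaf, rerouting the pair
  -- (x′ , e) for a leaf x′ beside e would need an edge strictly below e
  irrelevant-1-edge-inner : ∀ {l e} → IsEdge R e → l e ≡ true →
                            SameRel R l (toggle l e) → IsInner R e
  irrelevant-1-edge-inner {l} {e} (p , pe) le same leaf-e =
    let (x′ , lx′ , _ , ¬ex′) = sibling-leaf pe
        (w , (_ , l₀w , we , _) , ew) =
          reroute {l} {toggle l e} lx′ leaf-e (p , pe) ≼-refl ¬ex′ le e-off (SameRel⇒⊆ same)
    in labels-differ {toggle l e} l₀w e-off (≼-antisym we ew)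
    where
    e-off : toggle l e e ≡ false
    e-off = trans (toggle-same {l}) (cong not le)

  -- Toggling an irrelevant 1-edge e does not change which other edges are
  -- irrelevant.  Notation: l₀ = l with e switched off, ·ᶠ = with f toggled.
  module _ {l : Labeling R} {e} (le : l e ≡ true)
           (same : SameRel R l (toggle l e)) {f} (f≢e : f ≢ e) where
    private
      l₀ lᶠ l₀ᶠ : Labeling R
      l₀ = toggle l e
      lᶠ = toggle l f
      l₀ᶠ = toggle l₀ f

      e≢f : e ≢ f
      e≢f e≡f = f≢e (sym e≡f)

      l₀e : l₀ e ≡ false
      l₀e = trans (toggle-same {l}) (cong not le)

      l₀ᶠ-agrees : ∀ w → w ≢ e → l₀ᶠ w ≡ lᶠ w
      l₀ᶠ-agrees w w≢e with w ≟ f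
      ... | yes refl = cong not (toggle-other f≢e)
      ... | no _ = toggle-other w≢e

      l₀⊆l : l₀ ⊆𝒳 l
      l₀⊆l = ⊆-except-1-edge le (λ w → toggle-other)

      l⊆l₀ : l ⊆𝒳 l₀
      l⊆l₀ = SameRel⇒⊆ same

      l₀ᶠ⊆lᶠ : l₀ᶠ ⊆𝒳 lᶠ
      l₀ᶠ⊆lᶠ = ⊆-except-1-edge (trans (toggle-other e≢f) le) l₀ᶠ-agrees

      lᶠ⊆l₀ᶠ∪l : ∀ {x y} → 𝒳 R lᶠ x y → 𝒳 R l₀ᶠ x y ⊎ 𝒳 R l x y
      lᶠ⊆l₀ᶠ∪l (lx , ly , x≢y , w , witness) with w ≟ e
      ... | yes refl = inj₂ (lx , ly , x≢y , w , relabel {lᶠ} {l} (sym (toggle-other e≢f)) witness)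
      ... | no w≢e = inj₁ (lx , ly , x≢y , w , relabel {lᶠ} {l₀ᶠ} (l₀ᶠ-agrees w w≢e) witness)

      -- A
      -- pair of l₀ explained only through f, whose lᶠ-witness is e, has both e
      -- and f on its path; rerouting below the lower of the two yields a
      -- witness avoiding both.
      kept-without-e : l f ≡ true → l ⊆𝒳 lᶠ → l₀ ⊆𝒳 l₀ᶠ
      kept-without-e lf kept {x} {y} pair@(lx , ly , x≢y , w , l₀-witness@(ew , l₀w , wy , ¬wx))
        with w ≟ f
      ... | no w≢f = lx , ly , x≢y , w , relabel {l₀} {l₀ᶠ} (toggle-other w≢f) l₀-witness
      ... | yes refl with kept (l₀⊆l pair)
      ...   | _ , _ , _ , v , lᶠ-witness@(ev , lᶠv , vy , ¬vx) with v ≟ e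
      ...     | no v≢e = lx , ly , x≢y , v , relabel {lᶠ} {l₀ᶠ} (l₀ᶠ-agrees v v≢e) lᶠ-witness
      ...     | yes refl with ≼-linear vy wy
      ...       | inj₁ e≼f =
        let (u , witness , f≼u) = reroute lx ly ew wy ¬wx l₀w f-off (λ p → kept (l₀⊆l p))
        in lx , ly , x≢y , u ,
           relabel {lᶠ} {l₀ᶠ} (l₀ᶠ-agrees u (below-not-above e≼f f≼u e≢f)) witness
        where
        f-off : lᶠ f ≡ false
        f-off = trans (toggle-same {l}) (cong not lf)
      ...       | inj₂ f≼e =
        let (u , witness , e≼u) = reroute lx ly ev vy ¬vx lᶠv l₀e (λ p → l⊆l₀ (lᶠ⊆l p))
        in lx , ly , x≢y , u ,
           relabel {l₀} {l₀ᶠ} (toggle-other {l₀} (below-not-above f≼e e≼u f≢e)) witness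
        where
        lᶠ⊆l : lᶠ ⊆𝒳 l
        lᶠ⊆l = ⊆-except-1-edge lf (λ w → toggle-other)

    toggling-irrelevant-1-edge : Irrelevant R (toggle l e) f ⇔ Irrelevant R l f
    toggling-irrelevant-1-edge = by-label (l f) refl
      where
      by-label : ∀ b → l f ≡ b → Irrelevant R l₀ f ⇔ Irrelevant R l f
      by-label true lf = ⇔.trans (irrelevant-1-edge (trans (toggle-other f≢e) lf))
                           (⇔.trans (mk⇔ keep (kept-without-e lf)) (⇔.sym (irrelevant-1-edge lf)))
        where
        keep : l₀ ⊆𝒳 l₀ᶠ → l ⊆𝒳 lᶠ
        keep kept₀ pair = l₀ᶠ⊆lᶠ (kept₀ (l⊆l₀ pair))
      by-label false lf = ⇔.trans (irrelevant-0-edge (trans (toggle-other f≢e) lf))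
                            (⇔.trans (mk⇔ to from) (⇔.sym (irrelevant-0-edge lf)))
        where
        to : l₀ᶠ ⊆𝒳 l₀ → lᶠ ⊆𝒳 l
        to none₀ pair = [ (λ p → l₀⊆l (none₀ p)) , (λ p → p) ] (lᶠ⊆l₀ᶠ∪l pair)
        from : lᶠ ⊆𝒳 l → l₀ᶠ ⊆𝒳 l₀
        from none pair = l⊆l₀ (none (l₀ᶠ⊆lᶠ pair))

module Contraction (T : RTree) (_≟_ : DecidableEquality (RTree.V T)) (ph : Phylogenetic T)
                   {e pe : RTree.V T} (pe-e : RTree.parent T e ≡ just pe) where
  open RTree T
  open Ancestry T using (Anc; here; there; Anc⇒≼; ≼⇒Anc)
  open PhylogeneticTree T _≟_ ph using (acyclic)

  Tₑ : RTree
  Tₑ = contract T _≟_ e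

  Vₑ : Set
  Vₑ = RTree.V Tₑ

  parentₑ : Vₑ → Maybe Vₑ
  parentₑ = RTree.parent Tₑ

  vertex-≡ : ∀ {a b : Vₑ} → proj₁ a ≡ proj₁ b → a ≡ b
  vertex-≡ {u , p} {.u , q} refl = cong (u ,_) (T-irrelevant p q)

  _≟ₑ_ : DecidableEquality Vₑ
  a ≟ₑ b = map′ vertex-≡ (cong proj₁) (proj₁ a ≟ proj₁ b)

  pe≢e : False (pe ≟ e)
  pe≢e = fromWitnessFalse (λ { refl → acyclic pe-e here })

  lower : Maybe Vₑ → Maybe V
  lower = Data.Maybe.map proj₁

  lower-just : ∀ m {q} (q≢e : False (q ≟ e)) → lower m ≡ just q → m ≡ just (q , q≢e)
  lower-just (just _) _ refl = cong just (vertex-≡ refl)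

  parentₑ-root : ∀ u → parent (proj₁ u) ≡ nothing → parentₑ u ≡ nothing
  parentₑ-root (u , _) pu rewrite pu = refl

  parentₑ-keep : ∀ u {q} → parent (proj₁ u) ≡ just q → (q≢e : False (q ≟ e)) →
                 parentₑ u ≡ just (q , q≢e)
  parentₑ-keep u {q} pu q≢e = lower-just (parentₑ u) q≢e (lowered u pu (toWitnessFalse q≢e))
    where
    lowered : ∀ u → parent (proj₁ u) ≡ just q → q ≢ e → lower (parentₑ u) ≡ just q
    lowered (u , _) pu q≢e rewrite pu with q ≟ e
    ... | yes q≡e = ⊥-elim (q≢e q≡e)
    ... | no _ with q ≟ e
    ...   | yes q≡e = ⊥-elim (q≢e q≡e)
    ...   | no _ = refl

  parentₑ-skip : ∀ u → parent (proj₁ u) ≡ just e → parentₑ u ≡ just (pe , pe≢e)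
  parentₑ-skip u pu = lower-just (parentₑ u) pe≢e (lowered u pu)
    where
    lowered : ∀ u → parent (proj₁ u) ≡ just e → lower (parentₑ u) ≡ just pe
    lowered (u , _) pu rewrite pu with e ≟ e
    ... | no e≢e = ⊥-elim (e≢e refl)
    ... | yes _ rewrite pe-e with pe ≟ e
    ...   | yes pe≡e = ⊥-elim (toWitnessFalse pe≢e pe≡e)
    ...   | no _ = refl

  parentₑ-inv : ∀ u c → parentₑ u ≡ just c →
                parent (proj₁ u) ≡ just (proj₁ c) ⊎ (parent (proj₁ u) ≡ just e × pe ≡ proj₁ c)
  parentₑ-inv u c puc = by-parent (parent (proj₁ u)) refl
    where
    by-parent : ∀ m → parent (proj₁ u) ≡ m →
                parent (proj₁ u) ≡ just (proj₁ c) ⊎ (parent (proj₁ u) ≡ just e × pe ≡ proj₁ c)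
    by-parent nothing pu with () ← trans (sym (parentₑ-root u pu)) puc
    by-parent (just q) pu with q ≟ e
    ... | yes refl = inj₂ (pu , cong proj₁ (just-injective (trans (sym (parentₑ-skip u pu)) puc)))
    ... | no q≢e = inj₁ (trans pu (cong (just ∘ proj₁)
                     (just-injective (trans (sym (parentₑ-keep u pu (fromWitnessFalse q≢e))) puc))))

  module Aₑ = Ancestry Tₑ

  Ancₑ⇒Anc : ∀ {a b} → Aₑ.Anc a b → Anc (proj₁ a) (proj₁ b)
  Ancₑ⇒Anc Aₑ.here = here
  Ancₑ⇒Anc (Aₑ.there {y = b} {p = c} pbc r) with parentₑ-inv b c pbc
  ... | inj₁ pb = there pb (Ancₑ⇒Anc r)
  ... | inj₂ (pb , refl) = there pb (there pe-e (Ancₑ⇒Anc r))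

  Anc⇒Ancₑ : ∀ {w y} → Anc w y → (w≢e : False (w ≟ e)) (y≢e : False (y ≟ e)) →
             Aₑ.Anc (w , w≢e) (y , y≢e)
  Anc⇒Ancₑ here w≢e y≢e = subst (Aₑ.Anc (_ , w≢e)) (vertex-≡ refl) Aₑ.here
  Anc⇒Ancₑ (there {y = y} {p = p} py r) w≢e y≢e with p ≟ e
  ... | no p≢e = Aₑ.there (parentₑ-keep (y , y≢e) py (fromWitnessFalse p≢e))
                          (Anc⇒Ancₑ r w≢e (fromWitnessFalse p≢e))
  ... | yes refl with r
  ...   | here = ⊥-elim (toWitnessFalse w≢e refl)
  ...   | there pe-e′ r′ with trans (sym pe-e) pe-e′
  ...     | refl = Aₑ.there (parentₑ-skip (y , y≢e) py) (Anc⇒Ancₑ r′ w≢e pe≢e)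

  ≼ₑ⇒≼ : ∀ {a b} → _≼_ Tₑ a b → _≼_ T (proj₁ a) (proj₁ b)
  ≼ₑ⇒≼ ab = Anc⇒≼ (Ancₑ⇒Anc (Aₑ.≼⇒Anc ab))

  ≼⇒≼ₑ : ∀ {a b} → _≼_ T (proj₁ a) (proj₁ b) → _≼_ Tₑ a b
  ≼⇒≼ₑ {_ , a≢e} {_ , b≢e} ab = Aₑ.Anc⇒≼ (Anc⇒Ancₑ (≼⇒Anc ab) a≢e b≢e)

  edgeₑ⇒edge : ∀ w → IsEdge Tₑ w → IsEdge T (proj₁ w)
  edgeₑ⇒edge w (c , pwc) with parentₑ-inv w c pwc
  ... | inj₁ pw = _ , pw
  ... | inj₂ (pw , _) = _ , pw

  edge⇒edgeₑ : ∀ w → IsEdge T (proj₁ w) → IsEdge Tₑ w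
  edge⇒edgeₑ w (q , pw) with q ≟ e
  ... | yes refl = _ , parentₑ-skip w pw
  ... | no q≢e = _ , parentₑ-keep w pw (fromWitnessFalse q≢e)

  -- a T-leaf stays a leaf: a child in Tₑ is a child in T or a child of e whose
  -- new parent pe would then have e as a child
  leaf⇒leafₑ : ∀ u → IsLeaf T (proj₁ u) → IsLeaf Tₑ u
  leaf⇒leafₑ u leaf v pvu with parentₑ-inv v u pvu
  ... | inj₁ pv = leaf (proj₁ v) pv
  ... | inj₂ (_ , refl) = leaf e pe-e

  -- the Tₑ-leaves are the T-leaves, because e itself has children
  leafₑ⇒leaf : IsInner T e → ∀ u → IsLeaf Tₑ u → IsLeaf T (proj₁ u)
  leafₑ⇒leaf e-inner u leaf v pv with v ≟ e
  ... | no v≢e = leaf vₑ (parentₑ-keep vₑ pv (proj₂ u))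
    where
    vₑ : Vₑ
    vₑ = v , fromWitnessFalse v≢e
  ... | yes refl with Phylogenetic.branching ph e e-inner
  ...   | a , _ , _ , pa , _ =
    leaf (a , a≢e) (trans (parentₑ-skip (a , a≢e) pa)
                          (cong just (vertex-≡ (just-injective (trans (sym pe-e) pv)))))
    where
    a≢e : False (a ≟ e)
    a≢e = fromWitnessFalse (λ { refl → acyclic pa here })

  module L = Labelings T _≟_
  module Lₑ = Labelings Tₑ _≟ₑ_

  ctr : Labeling T → Labeling Tₑ
  ctr = contractLab T _≟_ e

  ctr-toggle : ∀ μ f (f≢e : False (f ≟ e)) → ctr (L.toggle μ f) ≗ Lₑ.toggle (ctr μ) (f , f≢e)
  ctr-toggle μ f f≢e w with proj₁ w ≟ f
  ... | yes _ = refl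
  ... | no _ = refl

  module _ (e-inner : IsInner T e) where
    𝒳-contract : ∀ {μ} → μ e ≡ false → ∀ x y → 𝒳 Tₑ (ctr μ) x y ⇔ 𝒳 T μ (proj₁ x) (proj₁ y)
    𝒳-contract {μ} μe x y = mk⇔ to from
      where
      to : 𝒳 Tₑ (ctr μ) x y → 𝒳 T μ (proj₁ x) (proj₁ y)
      to (lx , ly , x≢y , w , ew , μw , wy , ¬wx) =
        leafₑ⇒leaf e-inner x lx , leafₑ⇒leaf e-inner y ly , x≢y ∘ vertex-≡ ,
        proj₁ w , edgeₑ⇒edge w ew , μw , ≼ₑ⇒≼ wy , ¬wx ∘ ≼⇒≼ₑ
      from : 𝒳 T μ (proj₁ x) (proj₁ y) → 𝒳 Tₑ (ctr μ) x y
      from (lx , ly , x≢y , w , ew , μw , wy , ¬wx) =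
        leaf⇒leafₑ x lx , leaf⇒leafₑ y ly , x≢y ∘ cong proj₁ ,
        wₑ , edge⇒edgeₑ wₑ ew , μw , ≼⇒≼ₑ wy , ¬wx ∘ ≼ₑ⇒≼
        where
        wₑ : Vₑ
        wₑ = w , fromWitnessFalse (L.labels-differ μw μe)

    -- e is no leaf, so it occurs in no pair and contraction loses nothing
    SameRel-contract : ∀ {μ ν} → μ e ≡ false → ν e ≡ false →
                       SameRel Tₑ (ctr μ) (ctr ν) ⇔ SameRel T μ ν
    SameRel-contract {μ} {ν} μe νe = mk⇔ to from
      where
      to : SameRel Tₑ (ctr μ) (ctr ν) → SameRel T μ ν
      to same x y with x ≟ e | y ≟ e
      ... | yes refl | _ = mk⇔ (⊥-elim ∘ e-inner ∘ proj₁) (⊥-elim ∘ e-inner ∘ proj₁)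
      ... | no _ | yes refl =
        mk⇔ (⊥-elim ∘ e-inner ∘ proj₁ ∘ proj₂) (⊥-elim ∘ e-inner ∘ proj₁ ∘ proj₂)
      ... | no x≢e | no y≢e =
        ⇔.trans (⇔.sym (𝒳-contract μe xₑ yₑ)) (⇔.trans (same xₑ yₑ) (𝒳-contract νe xₑ yₑ))
        where
        xₑ yₑ : Vₑ
        xₑ = x , fromWitnessFalse x≢e
        yₑ = y , fromWitnessFalse y≢e
      from : SameRel T μ ν → SameRel Tₑ (ctr μ) (ctr ν)
      from same x y =
        ⇔.trans (𝒳-contract μe x y) (⇔.trans (same _ _) (⇔.sym (𝒳-contract νe x y)))

    irrelevant-contract : ∀ {μ} → μ e ≡ false → ∀ f (f≢e : False (f ≟ e)) →
                          Irrelevant Tₑ (ctr μ) (f , f≢e) ⇔ Irrelevant T μ f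
    irrelevant-contract {μ} μe f f≢e =
      ⇔.trans Lₑ.Irrelevant⇔toggle
        (⇔.trans (Lₑ.SameRel-respʳ (λ w → sym (ctr-toggle μ f f≢e w)))
          (⇔.trans (SameRel-contract μe μᶠe) (⇔.sym L.Irrelevant⇔toggle)))
      where
      μᶠe : L.toggle μ f e ≡ false
      μᶠe = trans (L.toggle-other {μ} (λ e≡f → toWitnessFalse f≢e (sym e≡f))) μe

lemma8 : (T : RTree) (_≟_ : DecidableEquality (RTree.V T)) → Phylogenetic T →
    (lab : Labeling T) (e : RTree.V T) → IsEdge T e →
    ((IsInnerEdge T e × lab e ≡ false) ⊎ (lab e ≡ true × Irrelevant T lab e)) →
    (f : RTree.V T) (f≢e : False (f ≟ e)) → IsEdge T f →
    (Relevant (contract T _≟_ e) (contractLab T _≟_ e lab) (f , f≢e) ⇔ Relevant T lab f)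
lemma8 T _≟_ ph lab e e-edge@(_ , pe-e) kind f f≢e _ = ¬-cong-⇔ (irrelevance-preserved kind)
  where
  open Contraction T _≟_ ph pe-e
  open IrrelevantOneEdges T _≟_ ph

  irrelevance-preserved : (IsInnerEdge T e × lab e ≡ false) ⊎ (lab e ≡ true × Irrelevant T lab e) →
                          Irrelevant Tₑ (ctr lab) (f , f≢e) ⇔ Irrelevant T lab f
  irrelevance-preserved (inj₁ ((_ , e-inner) , le)) = irrelevant-contract e-inner le f f≢e
  -- an irrelevant 1-edge is inner, and switching it off changes neither the
  -- contracted labeling nor the irrelevance of f
  irrelevance-preserved (inj₂ (le , irr)) =
    ⇔.trans (Lₑ.Irrelevant-cong ctr-switch-off)
      (⇔.trans (irrelevant-contract e-inner (trans (L.toggle-same {lab}) (cong not le)) f f≢e)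
        (toggling-irrelevant-1-edge le same (toWitnessFalse f≢e)))
    where
    same : SameRel T lab (L.toggle lab e)
    same = Equivalence.to L.Irrelevant⇔toggle irr
    e-inner : IsInner T e
    e-inner = irrelevant-1-edge-inner e-edge le same
    ctr-switch-off : ctr lab ≗ ctr (L.toggle lab e)
    ctr-switch-off (w , w≢e) = sym (L.toggle-other {lab} (toWitnessFalse w≢e))
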